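{- Let $M$ be a matroid and let $g:\mathcal{Z}^{\circ}(M)\to 2^{2^{E(M)}}$ be a function with the property that whenever $g(F_1)\cap g(F_2)\neq\emptyset$, then $F_1\vee F_2\in\mathcal{Z}^{\circ}(M)$ and $g(F_1)\cap g(F_2)\subseteq g(F_1\vee F_2)$. Then $$\Bigl|\bigcup_{F\in\mathcal{Z}^{\circ}(M)}g(F)\Bigr|=\sum_{\substack{S\subseteq\mathcal{Z}^{\circ}(M)\\ S\neq\emptyset}}(-1)^{|S|+1}\Bigl|\bigcap_{F\in S}g(F)\Bigr|=\sum_{\substack{\text{nonempty chains}\\ S\subseteq\mathcal{Z}^{\circ}(M)}}(-1)^{|S|+1}\Bigl|\bigcap_{F\in S}g(F)\Bigr|.$$
   Context: All matroids are finite. A cyclic flat is a flat that is a (possibly empty) union of circuits; the cyclic flats of $M$ ordered by inclusion form a lattice $\mathcal{Z}(M)$ whose join is $F_1\vee F_2=\mathrm{cl}(F_1\cup F_2)$. $\mathcal{Z}^{\circ}(M)$ denotes the set of nonempty proper cyclic flats of $M$. $2^{2^{E(M)}}$ is the set of families of subsets of $E(M)$. -}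

module Defs where

open import Data.Nat using (ℕ; zero; suc; _<_; _⊔_; _≡ᵇ_)
open import Data.Bool using (Bool; true; false; _∧_; _∨_; not; if_then_else_)
open import Data.Fin using (Fin)
open import Data.Fin.Subset using (Subset; _⊆_; _∈_; _∉_; _∪_; ⁅_⁆; ∣_∣; inside; outside)
  renaming (⊥ to ∅ₛ; ⊤ to Eₛ)
open import Data.Fin.Subset.Properties using (_⊆?_; _∈?_)
open import Data.Vec using (Vec; []; _∷_; tabulate)
open import Data.Vec.Properties using (≡-dec)
import Data.Bool.Properties as BoolP
open import Data.List using (List; []; _∷_; map; _++_; filter; length; foldr)
open import Data.Bool.ListAction using (all; any)
open import Data.Integer using (ℤ; +_; -_) renaming (_+_ to _+ℤ_; _*_ to _*ℤ_)
open import Data.Product using (Σ; _×_; ∃-syntax)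
open import Relation.Nullary.Decidable using (⌊_⌋)
open import Relation.Binary.PropositionalEquality using (_≡_)

record Matroid (n : ℕ) : Set where
  field
    indep : Subset n → Bool
    I1 : indep ∅ₛ ≡ true
    I2 : ∀ X Y → Y ⊆ X → indep X ≡ true → indep Y ≡ true
    I3 : ∀ X Y → indep X ≡ true → indep Y ≡ true → ∣ X ∣ < ∣ Y ∣ →
         ∃[ e ] (e ∈ Y × e ∉ X × indep (X ∪ ⁅ e ⁆) ≡ true)
open Matroid public

_⊆ᵇ_ : ∀ {n} → Subset n → Subset n → Bool
X ⊆ᵇ Y = ⌊ X ⊆? Y ⌋

_∈ᵇ_ : ∀ {n} → Fin n → Subset n → Bool
e ∈ᵇ X = ⌊ e ∈? X ⌋

_==ₛ_ : ∀ {n} → Subset n → Subset n → Bool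
X ==ₛ Y = ⌊ ≡-dec BoolP._≟_ X Y ⌋

allSubsets : (n : ℕ) → List (Subset n)
allSubsets zero = [] ∷ []
allSubsets (suc n) = map (outside ∷_) (allSubsets n) ++ map (inside ∷_) (allSubsets n)

allElems : (n : ℕ) → List (Fin n)
allElems n = Data.List.tabulate (λ i → i)
  where import Data.List

maximum : List ℕ → ℕ
maximum = foldr _⊔_ 0

module _ {n : ℕ} (M : Matroid n) where

  rank : Subset n → ℕ
  rank X = maximum (map ∣_∣ (filter (λ Y → (Y ⊆? X) Relation.Nullary.Decidable.×-dec (indep M Y Data.Bool.≟ true)) (allSubsets n)))
    where import Relation.Nullary.Decidable
          import Data.Bool

  cl : Subset n → Subset n
  cl X = tabulate (λ e → rank (X ∪ ⁅ e ⁆) ≡ᵇ rank X)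

  isFlat : Subset n → Bool
  isFlat X = cl X ==ₛ X

  isCircuit : Subset n → Bool
  isCircuit C = not (indep M C) ∧
    all (λ Y → not (Y ⊆ᵇ C ∧ not (Y ==ₛ C)) ∨ indep M Y) (allSubsets n)

  -- X is a union of circuits: every element of X lies in a circuit contained in X
  isCyclic : Subset n → Bool
  isCyclic X = all (λ e → not (e ∈ᵇ X) ∨
                  any (λ C → isCircuit C ∧ C ⊆ᵇ X ∧ e ∈ᵇ C) (allSubsets n)) (allElems n)

  isCyclicFlat : Subset n → Bool
  isCyclicFlat X = isFlat X ∧ isCyclic X

  inZ° : Subset n → Bool
  inZ° X = isCyclicFlat X ∧ not (X ==ₛ ∅ₛ) ∧ not (X ==ₛ Eₛ)

  Z°list : List (Subset n)
  Z°list = filter (λ X → inZ° X Data.Bool.≟ true) (allSubsets n)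
    where import Data.Bool

  _∨Z_ : Subset n → Subset n → Subset n
  F₁ ∨Z F₂ = cl (F₁ ∪ F₂)

-- families of subsets of E, i.e. elements of 2^(2^E), as Boolean predicates
Family : ℕ → Set
Family n = Subset n → Bool

card : ∀ {n} → Family n → ℕ
card {n} 𝒜 = length (filter (λ X → 𝒜 X Data.Bool.≟ true) (allSubsets n))
  where import Data.Bool

-- all sublists of a list (= all subsets, when the list has no repetitions)
sublists : ∀ {A : Set} → List A → List (List A)
sublists [] = [] ∷ []
sublists (x ∷ xs) = sublists xs ++ map (x ∷_) (sublists xs)

isNonempty : ∀ {A : Set} → List A → Bool
isNonempty [] = false
isNonempty (_ ∷ _) = true

isChain : ∀ {n} → List (Subset n) → Bool
isChain S = all (λ F → all (λ G → F ⊆ᵇ G ∨ G ⊆ᵇ F) S) S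

-- (-1)^(k+1)
signP : ℕ → ℤ
signP zero = - (+ 1)
signP (suc k) = - signP k

sumℤ : List ℤ → ℤ
sumℤ = foldr _+ℤ_ (+ 0)

⋂g : ∀ {n} → (Subset n → Family n) → List (Subset n) → Family n
⋂g g S X = all (λ F → g F X) S

⋃g : ∀ {n} → (Subset n → Family n) → List (Subset n) → Family n
⋃g g S X = any (λ F → g F X) S

inclExcl : ∀ {n} → (Subset n → Family n) → List (List (Subset n)) → ℤ
inclExcl g Ss = sumℤ (map (λ S → signP (length S) *ℤ (+ card (⋂g g S))) Ss)

filterᵇ : ∀ {A : Set} → (A → Bool) → List A → List A
filterᵇ p [] = []
filterᵇ p (x ∷ xs) = if p x then x ∷ filterᵇ p xs else filterᵇ p xs

-- Both identities hold pointwise in X ⊆ E. Let K = {F ∈ Z° : X ∈ g(F)}; the contribution of X to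
-- either alternating sum is the alternating sum over the nonempty subsets (resp. chains) of K,
-- and it has to equal [K ≠ ∅]. Counting the empty set with sign −1, this says that the full
-- alternating sum vanishes when K ≠ ∅, because adjoining/removing a fixed m ∈ K is a
-- sign-reversing involution. For chains take m = max K, which exists since the hypothesis on g
-- makes K closed under joins; adjoining max K to a chain of K gives again a chain.
module Submission where

open import Defs
open import Data.Nat using (ℕ; suc; _≡ᵇ_)
open import Data.Nat.Properties using (≡⇒≡ᵇ)
open import Data.Bool using (Bool; true; false; _∧_; _∨_; if_then_else_; _≟_)
open import Data.Bool.Properties using (∧-identityʳ; ∨-zeroʳ; T-≡)
open import Data.Fin using (Fin)
open import Data.Fin.Subset using (Subset; _⊆_; _∈_; _∪_; ⁅_⁆; inside; outside)
open import Data.Fin.Subset.Properties using (⊆-refl; ⊆-trans; ⊆-antisym; p⊆p∪q; q⊆p∪q; x∈p∪q⁻; x∈⁅y⁆⇒x≡y; _⊆?_)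
open import Data.Vec using ([]; _∷_; lookup)
open import Data.Vec.Properties using (lookup∘tabulate; lookup⇒[]=)
open import Data.List using (List; []; _∷_; _++_; map; filter; length)
open import Data.List.Properties using (map-∘; length-++-sucʳ)
open import Data.List.Membership.Propositional using () renaming (_∈_ to _∈ˡ_)
open import Data.List.Membership.Propositional.Properties
  using (∈-++⁻; ∈-++⁺ˡ; ∈-++⁺ʳ; ∈-map⁺; ∈-map⁻; ∈-filter⁺; ∈-filter⁻)
open import Data.List.Relation.Unary.Any using (here; there)
open import Data.List.Relation.Unary.All as All using (All; []; _∷_)
open import Data.Bool.ListAction using (all; any)
open import Data.Integer using (ℤ; +_; -_; _+_; _*_)
open import Data.Integer.Properties
  using (+-identityˡ; +-identityʳ; +-assoc; +-inverseʳ; *-zeroʳ; *-distribˡ-+;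
         neg-distrib-+; neg-distribˡ-*; +-commutativeSemigroup)
open import Algebra.Properties.CommutativeSemigroup +-commutativeSemigroup using (interchange; xy∙z≈xz∙y)
open import Data.Product using (_×_; _,_; proj₁; proj₂; ∃; ∃-syntax)
open import Data.Sum using (inj₁; inj₂; [_,_])
open import Function using (id; _∘_; Equivalence)
open import Level using (Level)
open import Relation.Binary using (Rel; Transitive)
open import Relation.Nullary.Decidable using (isYes≗does; dec-true)
open import Relation.Binary.PropositionalEquality using (_≡_; refl; sym; trans; cong; cong₂; subst; module ≡-Reasoning)
open ≡-Reasoning

private
  variable
    A B : Set
    ℓ : Level

𝟙 : Bool → ℤ
𝟙 true = + 1
𝟙 false = + 0

∑ : List A → (A → ℤ) → ℤ
∑ xs f = sumℤ (map f xs)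

syntax ∑ xs (λ x → e) = ∑[ x ∈ xs ] e

∑-cong : ∀ xs {f g : A → ℤ} → (∀ {x} → x ∈ˡ xs → f x ≡ g x) → ∑ xs f ≡ ∑ xs g
∑-cong [] f≡g = refl
∑-cong (x ∷ xs) f≡g = cong₂ _+_ (f≡g (here refl)) (∑-cong xs (f≡g ∘ there))

∑-zero : ∀ xs {f : A → ℤ} → (∀ {x} → x ∈ˡ xs → f x ≡ + 0) → ∑ xs f ≡ + 0
∑-zero [] _ = refl
∑-zero (x ∷ xs) f≡0 = cong₂ _+_ (f≡0 (here refl)) (∑-zero xs (f≡0 ∘ there))

∑-++ : ∀ xs ys (f : A → ℤ) → ∑ (xs ++ ys) f ≡ ∑ xs f + ∑ ys f
∑-++ [] ys f = sym (+-identityˡ _)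
∑-++ (x ∷ xs) ys f = trans (cong (_+_ (f x)) (∑-++ xs ys f)) (sym (+-assoc (f x) _ _))

∑-+ : ∀ xs (f g : A → ℤ) → ∑[ x ∈ xs ] (f x + g x) ≡ ∑ xs f + ∑ xs g
∑-+ [] f g = refl
∑-+ (x ∷ xs) f g = trans (cong (_+_ (f x + g x)) (∑-+ xs f g)) (interchange (f x) (g x) _ _)

∑-neg : ∀ xs (f : A → ℤ) → ∑[ x ∈ xs ] (- f x) ≡ - ∑ xs f
∑-neg [] f = refl
∑-neg (x ∷ xs) f = trans (cong (_+_ (- f x)) (∑-neg xs f)) (sym (neg-distrib-+ (f x) _))

*-∑ : ∀ a xs (f : A → ℤ) → a * ∑ xs f ≡ ∑[ x ∈ xs ] (a * f x)
*-∑ a [] f = *-zeroʳ a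
*-∑ a (x ∷ xs) f = trans (*-distribˡ-+ a (f x) _) (cong (_+_ (a * f x)) (*-∑ a xs f))

∑-comm : ∀ (xs : List A) (ys : List B) (F : A → B → ℤ) →
         ∑[ x ∈ xs ] ∑[ y ∈ ys ] F x y ≡ ∑[ y ∈ ys ] ∑[ x ∈ xs ] F x y
∑-comm [] ys F = sym (∑-zero ys (λ _ → refl))
∑-comm (x ∷ xs) ys F =
  trans (cong (_+_ (∑ ys (F x))) (∑-comm xs ys F)) (sym (∑-+ ys (F x) _))

∑-filterᵇ : ∀ (q : A → Bool) xs (f : A → ℤ) →
            ∑ (filterᵇ q xs) f ≡ ∑[ x ∈ xs ] (if q x then f x else + 0)
∑-filterᵇ q [] f = refl
∑-filterᵇ q (x ∷ xs) f with q x
... | true = cong (_+_ (f x)) (∑-filterᵇ q xs f)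
... | false = trans (∑-filterᵇ q xs f) (sym (+-identityˡ _))

∑-count : ∀ (p : A → Bool) xs → + length (filter (λ x → p x ≟ true) xs) ≡ ∑[ x ∈ xs ] 𝟙 (p x)
∑-count p [] = refl
∑-count p (x ∷ xs) with p x
... | true = cong (_+_ (+ 1)) (∑-count p xs)
... | false = trans (∑-count p xs) (sym (+-identityˡ _))

∑-sublists-∷ : ∀ x xs (u : List A → ℤ) →
               ∑ (sublists (x ∷ xs)) u ≡ ∑ (sublists xs) u + ∑[ S ∈ sublists xs ] u (x ∷ S)
∑-sublists-∷ x xs u =
  trans (∑-++ (sublists xs) _ u) (cong (_+_ (∑ (sublists xs) u)) (cong sumℤ (sym (map-∘ (sublists xs)))))

∑-sublists-nonempty : ∀ xs (u : List A → ℤ) →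
  ∑[ S ∈ sublists xs ] (if isNonempty S then u S else + 0) ≡ ∑ (sublists xs) u + - u []
∑-sublists-nonempty [] u = sym (trans (cong (_+ - u []) (+-identityʳ (u []))) (+-inverseʳ (u [])))
∑-sublists-nonempty (x ∷ xs) u = begin
  ∑[ S ∈ sublists (x ∷ xs) ] (if isNonempty S then u S else + 0)
    ≡⟨ ∑-sublists-∷ x xs _ ⟩
  ∑[ S ∈ sublists xs ] (if isNonempty S then u S else + 0) + ∑[ S ∈ sublists xs ] u (x ∷ S)
    ≡⟨ cong (_+ ∑[ S ∈ sublists xs ] u (x ∷ S)) (∑-sublists-nonempty xs u) ⟩
  ∑ (sublists xs) u + - u [] + ∑[ S ∈ sublists xs ] u (x ∷ S)
    ≡⟨ xy∙z≈xz∙y (∑ (sublists xs) u) (- u []) _ ⟩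
  ∑ (sublists xs) u + ∑[ S ∈ sublists xs ] u (x ∷ S) + - u []
    ≡⟨ cong (_+ - u []) (∑-sublists-∷ x xs u) ⟨
  ∑ (sublists (x ∷ xs)) u + - u [] ∎

All-sublists : ∀ {P : A → Set} {L S} → All P L → S ∈ˡ sublists L → All P S
All-sublists {L = []} [] (here refl) = []
All-sublists {L = x ∷ xs} (Px ∷ Pxs) S∈ with ∈-++⁻ (sublists xs) S∈
... | inj₁ S∈ˡ = All-sublists Pxs S∈ˡ
... | inj₂ S∈ʳ with ∈-map⁻ (x ∷_) S∈ʳ
...   | S , S∈ , refl = Px ∷ All-sublists Pxs S∈

all-insert : ∀ (p : A → Bool) {y} B S → p y ≡ true → all p (B ++ y ∷ S) ≡ all p (B ++ S)
all-insert p [] S py = cong (_∧ all p S) py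
all-insert p (b ∷ B) S py = cong (_∧_ (p b)) (all-insert p B S py)

all-congᴬ : ∀ {p q : A → Bool} {U} → All (λ x → p x ≡ q x) U → all p U ≡ all q U
all-congᴬ [] = refl
all-congᴬ (px≡qx ∷ eqs) = cong₂ _∧_ px≡qx (all-congᴬ eqs)

allᴬ : ∀ {p : A → Bool} {U} → All (λ x → p x ≡ true) U → all p U ≡ true
allᴬ [] = refl
allᴬ (px ∷ pxs) = cong₂ _∧_ px (allᴬ pxs)

filterᵇ-cong : ∀ {p q : A → Bool} → (∀ x → p x ≡ q x) → ∀ xs → filterᵇ p xs ≡ filterᵇ q xs
filterᵇ-cong p≗q [] = refl
filterᵇ-cong {q = q} p≗q (x ∷ xs) rewrite p≗q x =
  cong (λ ys → if q x then x ∷ ys else ys) (filterᵇ-cong p≗q xs)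

any≡isNonempty∘filter : ∀ (p : A → Bool) L → any p L ≡ isNonempty (filter (λ x → p x ≟ true) L)
any≡isNonempty∘filter p [] = refl
any≡isNonempty∘filter p (x ∷ xs) with p x
... | true = refl
... | false = any≡isNonempty∘filter p xs

∑-sublists-filter : ∀ (p : A → Bool) L (u : List A → ℤ) → (∀ S → all p S ≡ false → u S ≡ + 0) →
                    ∑ (sublists L) u ≡ ∑ (sublists (filter (λ x → p x ≟ true) L)) u
∑-sublists-filter p [] u u≡0 = refl
∑-sublists-filter p (x ∷ xs) u u≡0 with p x in px
... | true = begin
  ∑ (sublists (x ∷ xs)) u
    ≡⟨ ∑-sublists-∷ x xs u ⟩
  ∑ (sublists xs) u + ∑[ S ∈ sublists xs ] u (x ∷ S)
    ≡⟨ cong₂ _+_ (∑-sublists-filter p xs u u≡0)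
                 (∑-sublists-filter p xs (u ∘ (x ∷_)) (λ S e → u≡0 (x ∷ S) (trans (cong (_∧ all p S) px) e))) ⟩
  ∑ (sublists K) u + ∑[ S ∈ sublists K ] u (x ∷ S)
    ≡⟨ ∑-sublists-∷ x K u ⟨
  ∑ (sublists (x ∷ K)) u ∎
  where K = filter (λ x → p x ≟ true) xs
... | false = begin
  ∑ (sublists (x ∷ xs)) u
    ≡⟨ ∑-sublists-∷ x xs u ⟩
  ∑ (sublists xs) u + ∑[ S ∈ sublists xs ] u (x ∷ S)
    ≡⟨ cong (_+_ (∑ (sublists xs) u)) (∑-zero (sublists xs) (λ {S} _ → u≡0 (x ∷ S) (cong (_∧ all p S) px))) ⟩
  ∑ (sublists xs) u + + 0
    ≡⟨ +-identityʳ _ ⟩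
  ∑ (sublists xs) u
    ≡⟨ ∑-sublists-filter p xs u u≡0 ⟩
  ∑ (sublists (filter (λ x → p x ≟ true) xs)) u ∎

∑-sublists-signReversing : ∀ (P : A → Set) m (u : List A → ℤ) →
  (∀ B S → All P (B ++ S) → u (B ++ m ∷ S) ≡ - u (B ++ S)) →
  ∀ {K} → m ∈ˡ K → All P K → ∑ (sublists K) u ≡ + 0
∑-sublists-signReversing P m u flip {_ ∷ xs} (here refl) (_ ∷ Pxs) = begin
  ∑ (sublists (m ∷ xs)) u
    ≡⟨ ∑-sublists-∷ m xs u ⟩
  ∑ (sublists xs) u + ∑[ S ∈ sublists xs ] u (m ∷ S)
    ≡⟨ cong (_+_ (∑ (sublists xs) u)) (∑-cong (sublists xs) (λ S∈ → flip [] _ (All-sublists Pxs S∈))) ⟩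
  ∑ (sublists xs) u + ∑[ S ∈ sublists xs ] (- u S)
    ≡⟨ cong (_+_ (∑ (sublists xs) u)) (∑-neg (sublists xs) u) ⟩
  ∑ (sublists xs) u + - ∑ (sublists xs) u
    ≡⟨ +-inverseʳ (∑ (sublists xs) u) ⟩
  + 0 ∎
∑-sublists-signReversing P m u flip {x ∷ xs} (there m∈) (Px ∷ Pxs) = begin
  ∑ (sublists (x ∷ xs)) u
    ≡⟨ ∑-sublists-∷ x xs u ⟩
  ∑ (sublists xs) u + ∑[ S ∈ sublists xs ] u (x ∷ S)
    ≡⟨ cong₂ _+_ (∑-sublists-signReversing P m u flip m∈ Pxs)
                 (∑-sublists-signReversing P m (u ∘ (x ∷_)) (λ B S PBS → flip (x ∷ B) S (Px ∷ PBS)) m∈ Pxs) ⟩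
  + 0 ∎

-- Lists stand for sets, so c has to be invariant under inserting m at every position.
Pivot : (List A → Bool) → List A → A → Set
Pivot c K m = m ∈ˡ K × (∀ B S → All (_∈ˡ K) (B ++ S) → c (B ++ m ∷ S) ≡ c (B ++ S))

module InclusionExclusion {A : Set} (p : A → Bool) (c : List A → Bool) where

  fibre : List A → List A
  fibre = filter (λ x → p x ≟ true)

  weight : Bool → ℕ → Bool → ℤ
  weight b k a = if b then signP k * 𝟙 a else + 0

  term : List A → ℤ
  term S = weight (c S) (length S) (all p S)

  weight-suc : ∀ b k a → weight b (suc k) a ≡ - weight b k a
  weight-suc true k a = sym (neg-distribˡ-* (signP k) (𝟙 a))
  weight-suc false k a = refl

  term-insert : ∀ {K m} → p m ≡ true → Pivot c K m →
                ∀ B S → All (_∈ˡ K) (B ++ S) → term (B ++ m ∷ S) ≡ - term (B ++ S)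
  term-insert {m = m} pm (_ , c-inv) B S BS⊆K = begin
    weight (c (B ++ m ∷ S)) (length (B ++ m ∷ S)) (all p (B ++ m ∷ S))
      ≡⟨ cong₂ (λ b a → weight b (length (B ++ m ∷ S)) a) (c-inv B S BS⊆K) (all-insert p B S pm) ⟩
    weight (c (B ++ S)) (length (B ++ m ∷ S)) (all p (B ++ S))
      ≡⟨ cong (λ k → weight (c (B ++ S)) k (all p (B ++ S))) (length-++-sucʳ B m S) ⟩
    weight (c (B ++ S)) (suc (length (B ++ S))) (all p (B ++ S))
      ≡⟨ weight-suc (c (B ++ S)) (length (B ++ S)) (all p (B ++ S)) ⟩
    - term (B ++ S) ∎

  term-vanishes : ∀ S → all p S ≡ false → term S ≡ + 0
  term-vanishes S notAll with c S
  ... | true = trans (cong (λ a → signP (length S) * 𝟙 a) notAll) (*-zeroʳ (signP (length S)))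
  ... | false = refl

  term-[] : c [] ≡ true → term [] ≡ - + 1
  term-[] c[] = cong (λ b → weight b 0 true) c[]

  ∑-sublists-pivoted : c [] ≡ true → ∀ K → All (λ x → p x ≡ true) K → (∀ {x} → x ∈ˡ K → ∃ (Pivot c K)) →
                       ∑ (sublists K) term ≡ 𝟙 (isNonempty K) + term []
  ∑-sublists-pivoted c[] [] _ _ = trans (+-identityʳ (term [])) (sym (+-identityˡ (term [])))
  ∑-sublists-pivoted c[] K@(_ ∷ _) pK pivot with pivot (here refl)
  ... | m , m∈ , c-inv = begin
    ∑ (sublists K) term
      ≡⟨ ∑-sublists-signReversing (_∈ˡ K) m term (term-insert (All.lookup pK m∈) (m∈ , c-inv)) m∈ (All.tabulate id) ⟩
    + 0
      ≡⟨ cong (_+_ (+ 1)) (term-[] c[]) ⟨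
    + 1 + term [] ∎

  inclusion-exclusion : c [] ≡ true → ∀ L → (∀ {x} → x ∈ˡ fibre L → ∃ (Pivot c (fibre L))) →
    ∑[ S ∈ filterᵇ (λ S → isNonempty S ∧ c S) (sublists L) ] (signP (length S) * 𝟙 (all p S)) ≡ 𝟙 (any p L)
  inclusion-exclusion c[] L pivot = begin
    ∑[ S ∈ filterᵇ (λ S → isNonempty S ∧ c S) (sublists L) ] (signP (length S) * 𝟙 (all p S))
      ≡⟨ ∑-filterᵇ (λ S → isNonempty S ∧ c S) (sublists L) _ ⟩
    ∑[ S ∈ sublists L ] (if isNonempty S ∧ c S then signP (length S) * 𝟙 (all p S) else + 0)
      ≡⟨ ∑-cong (sublists L) (λ { {[]} _ → refl ; {_ ∷ _} _ → refl }) ⟩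
    ∑[ S ∈ sublists L ] (if isNonempty S then term S else + 0)
      ≡⟨ ∑-sublists-nonempty L term ⟩
    ∑ (sublists L) term + - term []
      ≡⟨ cong (_+ - term []) (∑-sublists-filter p L term term-vanishes) ⟩
    ∑ (sublists (fibre L)) term + - term []
      ≡⟨ cong (_+ - term []) (∑-sublists-pivoted c[] (fibre L) fibre⊆p pivot) ⟩
    𝟙 (isNonempty (fibre L)) + term [] + - term []
      ≡⟨ +-assoc (𝟙 (isNonempty (fibre L))) (term []) (- term []) ⟩
    𝟙 (isNonempty (fibre L)) + (term [] + - term [])
      ≡⟨ cong (_+_ (𝟙 (isNonempty (fibre L)))) (+-inverseʳ (term [])) ⟩
    𝟙 (isNonempty (fibre L)) + + 0
      ≡⟨ +-identityʳ _ ⟩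
    𝟙 (isNonempty (fibre L))
      ≡⟨ cong 𝟙 (any≡isNonempty∘filter p L) ⟨
    𝟙 (any p L) ∎
    where
      fibre⊆p : All (λ x → p x ≡ true) (fibre L)
      fibre⊆p = All.tabulate (λ x∈ → proj₂ (∈-filter⁻ (λ x → p x ≟ true) {xs = L} x∈))

Directed : Rel A ℓ → List A → Set ℓ
Directed _≤_ K = ∀ {x y} → x ∈ˡ K → y ∈ˡ K → ∃[ z ] (z ∈ˡ K × x ≤ z × y ≤ z)

directed⇒maximum : ∀ {_≤_ : Rel A ℓ} {K} → Transitive _≤_ → Directed _≤_ K →
                   ∀ {x} → x ∈ˡ K → ∃[ m ] (m ∈ˡ K × All (_≤ m) K)
directed⇒maximum {_≤_ = _≤_} {K} ≤-trans directed {x} x∈ = bound K (All.tabulate id)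
  where
    bound : ∀ U → All (_∈ˡ K) U → ∃[ m ] (m ∈ˡ K × All (_≤ m) U)
    bound [] [] = x , x∈ , []
    bound (y ∷ U) (y∈ ∷ U⊆K) with bound U U⊆K
    ... | m , m∈ , U≤m with directed y∈ m∈
    ...   | z , z∈ , y≤z , m≤z = z , z∈ , y≤z ∷ All.map (λ u≤m → ≤-trans u≤m m≤z) U≤m

comparable : ∀ {n} → Subset n → Subset n → Bool
comparable F G = F ⊆ᵇ G ∨ G ⊆ᵇ F

⊆⇒⊆ᵇ : ∀ {n} {F G : Subset n} → F ⊆ G → F ⊆ᵇ G ≡ true
⊆⇒⊆ᵇ {F = F} {G} F⊆G = trans (isYes≗does (F ⊆? G)) (dec-true (F ⊆? G) F⊆G)

comparable-⊆ : ∀ {n} {F G : Subset n} → F ⊆ G → comparable F G ≡ true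
comparable-⊆ {F = F} {G} F⊆G = cong (_∨ G ⊆ᵇ F) (⊆⇒⊆ᵇ F⊆G)

comparable-⊇ : ∀ {n} {F G : Subset n} → G ⊆ F → comparable F G ≡ true
comparable-⊇ {F = F} {G} G⊆F = trans (cong (F ⊆ᵇ G ∨_) (⊆⇒⊆ᵇ G⊆F)) (∨-zeroʳ (F ⊆ᵇ G))

isChain-insert : ∀ {n} (m : Subset n) B S → All (_⊆ m) (B ++ S) → isChain (B ++ m ∷ S) ≡ isChain (B ++ S)
isChain-insert m B S BS⊆m = begin
  all (λ F → all (comparable F) (B ++ m ∷ S)) (B ++ m ∷ S)
    ≡⟨ all-insert (λ F → all (comparable F) (B ++ m ∷ S)) B S row-m ⟩
  all (λ F → all (comparable F) (B ++ m ∷ S)) (B ++ S)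
    ≡⟨ all-congᴬ (All.map {P = _⊆ m} (λ F⊆m → all-insert (comparable _) B S (comparable-⊆ F⊆m)) BS⊆m) ⟩
  all (λ F → all (comparable F) (B ++ S)) (B ++ S) ∎
  where
    row-m : all (comparable m) (B ++ m ∷ S) ≡ true
    row-m = trans (all-insert (comparable m) B S (comparable-⊆ (⊆-refl {x = m}))) (allᴬ (All.map {P = _⊆ m} comparable-⊇ BS⊆m))

chain-pivot : ∀ {n} {K : List (Subset n)} → Directed _⊆_ K → ∀ {x} → x ∈ˡ K → ∃ (Pivot isChain K)
chain-pivot directed x∈ with directed⇒maximum ⊆-trans directed x∈
... | m , m∈ , K⊆m = m , m∈ , λ B S BS⊆K → isChain-insert m B S (All.map (All.lookup K⊆m) BS⊆K)

∈-allSubsets : ∀ {n} (X : Subset n) → X ∈ˡ allSubsets n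
∈-allSubsets [] = here refl
∈-allSubsets (outside ∷ X) = ∈-++⁺ˡ (∈-map⁺ (outside ∷_) (∈-allSubsets X))
∈-allSubsets {suc n} (inside ∷ X) = ∈-++⁺ʳ (map (outside ∷_) (allSubsets n)) (∈-map⁺ (inside ∷_) (∈-allSubsets X))

x∈p⇒p∪⁅x⁆≡p : ∀ {n} {e : Fin n} {Y : Subset n} → e ∈ Y → Y ∪ ⁅ e ⁆ ≡ Y
x∈p⇒p∪⁅x⁆≡p {e = e} {Y} e∈Y = ⊆-antisym Y∪e⊆Y (p⊆p∪q ⁅ e ⁆)
  where
    Y∪e⊆Y : Y ∪ ⁅ e ⁆ ⊆ Y
    Y∪e⊆Y x∈ = [ id , (λ x∈e → subst (_∈ Y) (sym (x∈⁅y⁆⇒x≡y e x∈e)) e∈Y) ] (x∈p∪q⁻ Y ⁅ e ⁆ x∈)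

module _ {n} (M : Matroid n) where

  cl-extensive : ∀ Y → Y ⊆ cl M Y
  cl-extensive Y {e} e∈Y = lookup⇒[]= e (cl M Y) (begin
    lookup (cl M Y) e               ≡⟨ lookup∘tabulate _ e ⟩
    rank M (Y ∪ ⁅ e ⁆) ≡ᵇ rank M Y ≡⟨ cong (λ Z → rank M Z ≡ᵇ rank M Y) (x∈p⇒p∪⁅x⁆≡p e∈Y) ⟩
    rank M Y ≡ᵇ rank M Y           ≡⟨ Equivalence.to T-≡ (≡⇒≡ᵇ (rank M Y) (rank M Y) refl) ⟩
    true                            ∎)

  ⊆-∨Zˡ : ∀ F₁ F₂ → F₁ ⊆ _∨Z_ M F₁ F₂
  ⊆-∨Zˡ F₁ F₂ = cl-extensive (F₁ ∪ F₂) ∘ p⊆p∪q F₂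

  ⊆-∨Zʳ : ∀ F₁ F₂ → F₂ ⊆ _∨Z_ M F₁ F₂
  ⊆-∨Zʳ F₁ F₂ = cl-extensive (F₁ ∪ F₂) ∘ q⊆p∪q F₁ F₂

  JoinCompatible : (Subset n → Family n) → Set
  JoinCompatible g = ∀ F₁ F₂ → inZ° M F₁ ≡ true → inZ° M F₂ ≡ true →
    (∃[ X ] (g F₁ X ∧ g F₂ X) ≡ true) →
    (inZ° M (_∨Z_ M F₁ F₂) ≡ true) × (∀ X → (g F₁ X ∧ g F₂ X) ≡ true → g (_∨Z_ M F₁ F₂) X ≡ true)

  fibre-directed : ∀ {g} → JoinCompatible g → ∀ X → Directed _⊆_ (filter (λ F → g F X ≟ true) (Z°list M))
  fibre-directed {g} compatible X {F₁} {F₂} F₁∈ F₂∈ =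
    J , J∈ , ⊆-∨Zˡ F₁ F₂ , ⊆-∨Zʳ F₁ F₂
    where
      inZ? = λ F → inZ° M F ≟ true
      g? = λ F → g F X ≟ true
      J = _∨Z_ M F₁ F₂
      g₁ = proj₂ (∈-filter⁻ g? {xs = Z°list M} F₁∈)
      g₂ = proj₂ (∈-filter⁻ g? {xs = Z°list M} F₂∈)
      F₁° = proj₂ (∈-filter⁻ inZ? {xs = allSubsets n} (proj₁ (∈-filter⁻ g? {xs = Z°list M} F₁∈)))
      F₂° = proj₂ (∈-filter⁻ inZ? {xs = allSubsets n} (proj₁ (∈-filter⁻ g? {xs = Z°list M} F₂∈)))
      g₁₂ = cong₂ _∧_ g₁ g₂
      joined = compatible F₁ F₂ F₁° F₂° (X , g₁₂)
      J∈ = ∈-filter⁺ g? (∈-filter⁺ inZ? (∈-allSubsets J) (proj₁ joined)) (proj₂ joined X g₁₂)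

inclExcl≡∑ : ∀ {n} (g : Subset n → Family n) Ss →
             inclExcl g Ss ≡ ∑[ X ∈ allSubsets n ] ∑[ S ∈ Ss ] (signP (length S) * 𝟙 (⋂g g S X))
inclExcl≡∑ {n} g Ss = begin
  ∑[ S ∈ Ss ] (signP (length S) * + card (⋂g g S))
    ≡⟨ ∑-cong Ss (λ {S} _ → trans (cong (signP (length S) *_) (∑-count (⋂g g S) (allSubsets n)))
                                   (*-∑ (signP (length S)) (allSubsets n) (𝟙 ∘ ⋂g g S))) ⟩
  ∑[ S ∈ Ss ] ∑[ X ∈ allSubsets n ] (signP (length S) * 𝟙 (⋂g g S X))
    ≡⟨ ∑-comm Ss (allSubsets n) _ ⟩
  ∑[ X ∈ allSubsets n ] ∑[ S ∈ Ss ] (signP (length S) * 𝟙 (⋂g g S X)) ∎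

lemma3p1 : {n : ℕ} (M : Matroid n) (g : Subset n → Family n) →
    (∀ F₁ F₂ → inZ° M F₁ ≡ true → inZ° M F₂ ≡ true →
      (∃[ X ] (g F₁ X ∧ g F₂ X) ≡ true) →
      (inZ° M (_∨Z_ M F₁ F₂) ≡ true) ×
      (∀ X → (g F₁ X ∧ g F₂ X) ≡ true → g (_∨Z_ M F₁ F₂) X ≡ true)) →
    ((+ card (⋃g g (Z°list M))) ≡ inclExcl g (filterᵇ isNonempty (sublists (Z°list M))))
    × (inclExcl g (filterᵇ isNonempty (sublists (Z°list M)))
        ≡ inclExcl g (filterᵇ (λ S → isNonempty S ∧ isChain S) (sublists (Z°list M))))
lemma3p1 {n} M g compatible = union≡IE , IE≡chainIE
  where
    Z = Z°list M
    subsets = filterᵇ isNonempty (sublists Z)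
    chains = filterᵇ (λ S → isNonempty S ∧ isChain S) (sublists Z)

    IE : List (List (Subset n)) → Subset n → ℤ
    IE Ss X = ∑[ S ∈ Ss ] (signP (length S) * 𝟙 (⋂g g S X))

    IE-subsets : ∀ X → IE subsets X ≡ 𝟙 (⋃g g Z X)
    IE-subsets X = trans (cong (λ Ss → IE Ss X) (filterᵇ-cong (λ S → sym (∧-identityʳ (isNonempty S))) (sublists Z)))
      (InclusionExclusion.inclusion-exclusion (λ F → g F X) (λ _ → true) refl Z (λ x∈ → _ , x∈ , λ _ _ _ → refl))

    IE-chains : ∀ X → IE chains X ≡ 𝟙 (⋃g g Z X)
    IE-chains X = InclusionExclusion.inclusion-exclusion (λ F → g F X) isChain refl Z
      (chain-pivot (fibre-directed M compatible X))

    union≡IE = begin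
      + card (⋃g g Z)                      ≡⟨ ∑-count (⋃g g Z) (allSubsets n) ⟩
      ∑[ X ∈ allSubsets n ] 𝟙 (⋃g g Z X) ≡⟨ ∑-cong (allSubsets n) (λ {X} _ → IE-subsets X) ⟨
      ∑[ X ∈ allSubsets n ] IE subsets X ≡⟨ inclExcl≡∑ g subsets ⟨
      inclExcl g subsets                   ∎

    IE≡chainIE = begin
      inclExcl g subsets                   ≡⟨ inclExcl≡∑ g subsets ⟩
      ∑[ X ∈ allSubsets n ] IE subsets X ≡⟨ ∑-cong (allSubsets n) (λ {X} _ → trans (IE-subsets X) (sym (IE-chains X))) ⟩
      ∑[ X ∈ allSubsets n ] IE chains X  ≡⟨ inclExcl≡∑ g chains ⟨
      inclExcl g chains                    ∎
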